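{- Let $w$ be a binary word over $\{0,1\}$. For each integer $i\in\{3,\dots,|w|+3\}$ there exist integers $j,j'$ (with $i\le j,j'\le|w|+3$) such that $\mathrm{Left}_i(\mathrm{Right}_j(\mathrm{RC}(w)))$ and $\mathrm{Right}_i(\mathrm{Left}_{j'}(\mathrm{RC}(w)))$ are fully leafed caterpillar subsequences of $\mathrm{RC}(w)$.
   Context: A caterpillar sequence is a finite sequence $S=(s_1,\dots,s_k)$, $k\ge1$, of non-negative integers with $s_1,s_k\ge1$, and $s_1\ge2$ if $k=1$; size $|S|=k+\sum_j s_j$, number of leaves $\ell(S)=\sum_j s_j$. Let $f(S)=(s_1)$ if $k=1$ and $f(S)=(s_1+1,s_2+2,\dots,s_{k-1}+2,s_k+1)$ if $k>1$; $S'\preceq S$ (caterpillar subsequence) means $S'$ has length $k'\le k$ and there is $i\in\{0,\dots,k-k'\}$ with $f(S')[j]\le f(S)[j+i]$ for $1\le j\le k'$. Let $L_S$ be the leaf function of the caterpillar graph of $S$ (a path $v_1,\dots,v_k$ with $s_j$ pendant leaves at $v_j$): $L_S(i)$ is the maximum number of degree-1 vertices in an induced subtree with $i$ vertices; for $i\ge3$ it equals $\max\{\ell(S'):S'\preceq S,\ |S'|=i\}$. A caterpillar subsequence $S'\preceq S$ with $|S'|=i$ is fully leafed if $\ell(S')=L_S(i)$. The reading caterpillar sequence: $\mathrm{RC}(\varepsilon)=(2)$ and, if $\mathrm{RC}(u)=(r_1,\dots,r_k)$, $\mathrm{RC}(u0)=(r_1,\dots,r_{k-1},r_k-1,1)$,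 $\mathrm{RC}(u1)=(r_1,\dots,r_{k-1},r_k+1)$. For $3\le i\le|S|$: $\mathrm{Left}_i(S)=S$ if $i=|S|$; $\mathrm{Left}_i(S)=\mathrm{Left}_i(s_1,\dots,s_{k-1},s_k-1)$ if $i<|S|$, $s_k\ge2$; $\mathrm{Left}_i(S)=\mathrm{Left}_i(s_1,\dots,s_{k-2},s_{k-1}+1)$ if $i<|S|$, $s_k=1$. Symmetrically, $\mathrm{Right}_i(S)=S$ if $i=|S|$; $\mathrm{Right}_i(S)=\mathrm{Right}_i(s_1-1,s_2,\dots,s_k)$ if $i<|S|$, $s_1\ge2$; $\mathrm{Right}_i(S)=\mathrm{Right}_i(s_2+1,s_3,\dots,s_k)$ if $i<|S|$, $s_1=1$. -}

module Defs where

open import Data.Nat using (ℕ; zero; suc; _+_; _∸_; _≤_)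
open import Data.Bool using (Bool; true; false)
open import Data.List using (List; []; _∷_; _++_; length; foldl; take; drop)
open import Data.Nat.ListAction using (sum)
open import Data.Product using (_×_; ∃-syntax)
open import Data.Empty using (⊥)
open import Relation.Binary.PropositionalEquality using (_≡_)

lastOr : ℕ → List ℕ → ℕ
lastOr d [] = d
lastOr d (x ∷ xs) = lastOr x xs

IsCaterpillar : List ℕ → Set
IsCaterpillar [] = ⊥
IsCaterpillar (x ∷ []) = 2 ≤ x
IsCaterpillar (x ∷ y ∷ r) = (1 ≤ x) × (1 ≤ lastOr y r)

leaves : List ℕ → ℕ
leaves = sum

size : List ℕ → ℕ
size S = length S + leaves S

private
  fmid : List ℕ → List ℕ
  fmid [] = []
  fmid (z ∷ []) = suc z ∷ []
  fmid (z ∷ z' ∷ r) = suc (suc z) ∷ fmid (z' ∷ r)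

f : List ℕ → List ℕ
f [] = []
f (x ∷ []) = x ∷ []
f (x ∷ y ∷ r) = suc x ∷ fmid (y ∷ r)

data _≤*_ : List ℕ → List ℕ → Set where
  []≤ : ∀ {ys} → [] ≤* ys
  ∷≤ : ∀ {x y xs ys} → x ≤ y → xs ≤* ys → (x ∷ xs) ≤* (y ∷ ys)

_⪯_ : List ℕ → List ℕ → Set
S' ⪯ S = ∃[ i ] ((i + length S' ≤ length S) × (f S' ≤* drop i (f S)))

FullyLeafed : List ℕ → List ℕ → ℕ → Set
FullyLeafed S S' i =
  IsCaterpillar S' × (S' ⪯ S) × (size S' ≡ i) ×
  (∀ T → IsCaterpillar T → T ⪯ S → size T ≡ i → leaves T ≤ leaves S')

-- Reading caterpillar sequence; binary letters: false = 0, true = 1.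
decLast : List ℕ → List ℕ
decLast [] = []
decLast (x ∷ []) = (x ∸ 1) ∷ []
decLast (x ∷ y ∷ r) = x ∷ decLast (y ∷ r)

incLast : List ℕ → List ℕ
incLast [] = []
incLast (x ∷ []) = suc x ∷ []
incLast (x ∷ y ∷ r) = x ∷ incLast (y ∷ r)

rcStep : List ℕ → Bool → List ℕ
rcStep S false = decLast S ++ (1 ∷ [])
rcStep S true = incLast S

RC : List Bool → List ℕ
RC w = foldl rcStep (2 ∷ []) w

stepL : List ℕ → List ℕ
stepL [] = []
stepL (x ∷ []) = (x ∸ 1) ∷ []
stepL (x ∷ suc (suc y) ∷ []) = x ∷ suc y ∷ []
stepL (x ∷ 1 ∷ []) = suc x ∷ []
stepL (x ∷ 0 ∷ []) = x ∷ []          -- never reached on caterpillar sequences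
stepL (x ∷ y ∷ z ∷ r) = x ∷ stepL (y ∷ z ∷ r)

stepR : List ℕ → List ℕ
stepR [] = []
stepR (suc (suc a) ∷ r) = suc a ∷ r
stepR (1 ∷ b ∷ r) = suc b ∷ r
stepR (1 ∷ []) = []                  -- never reached
stepR (0 ∷ r) = r                    -- never reached

iter : ℕ → (List ℕ → List ℕ) → List ℕ → List ℕ
iter zero g S = S
iter (suc n) g S = iter n g (g S)

-- Each step decreases |S| by exactly one, so Left_i(S) is obtained after |S| - i steps.
Left : ℕ → List ℕ → List ℕ
Left i S = iter (size S ∸ i) stepL S

Right : ℕ → List ℕ → List ℕ
Right i S = iter (size S ∸ i) stepR S

{-# OPTIONS --safe #-}
-- Reading w, every 0 opens a new entry of RC w and every 1 adds a leaf to the last one, so RC w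
-- and f (RC w) have explicit block descriptions (blocks, fBlocks).  One step of Left (of Right)
-- undoes the last (the first) letter, hence Left ∘ Right and Right ∘ Left cut RC w down to RC u
-- for a factor u of w, which has |u| + 3 vertices and 2 + (number of 1s of u) leaves.
-- Conversely, a caterpillar subsequence with k spine vertices and n + 3 vertices is dominated by
-- k consecutive entries of f (RC w); summing them shows that the n letters of w under it contain
-- at most k - 1 zeros, so it has n + 3 - k ≤ 2 + (number of 1s) leaves.  Taking for u a factor of
-- length n with the most 1s therefore yields a fully leafed subsequence.
module Submission where

open import Defs
open import Data.Nat using (ℕ; zero; suc; _+_; _∸_; _≤_; z≤n; s≤s; _≤?_)
open import Data.Nat.Properties
open import Data.Nat.ListAction using (sum)
open import Data.Nat.Tactic.RingSolver using (solve-∀)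
open import Data.Bool using (Bool; true; false)
open import Data.List using (List; []; _∷_; _++_; _∷ʳ_; length; foldl; take; drop)
open import Data.List.Properties
  using (++-assoc; ++-identityʳ; ∷ʳ-++; ∷-injectiveʳ; take++drop≡id; foldl-∷ʳ;
         length-++; length-++-≤ˡ; length-++-≤ʳ; length-take)
open import Data.Product using (_×_; _,_; ∃-syntax; ∃₂)
open import Relation.Nullary using (yes; no)
open import Relation.Binary.PropositionalEquality

ones : List Bool → ℕ
ones [] = 0
ones (true ∷ v) = suc (ones v)
ones (false ∷ v) = ones v

zeros : List Bool → ℕ
zeros [] = 0
zeros (true ∷ v) = zeros v
zeros (false ∷ v) = suc (zeros v)

ones+zeros≡length : ∀ v → ones v + zeros v ≡ length v
ones+zeros≡length [] = refl
ones+zeros≡length (true ∷ v) = cong suc (ones+zeros≡length v)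
ones+zeros≡length (false ∷ v) = trans (+-suc (ones v) (zeros v)) (cong suc (ones+zeros≡length v))

zeros-++ : ∀ x v → zeros (x ++ v) ≡ zeros x + zeros v
zeros-++ [] v = refl
zeros-++ (true ∷ x) v = zeros-++ x v
zeros-++ (false ∷ x) v = cong suc (zeros-++ x v)

ones-≤-++ : ∀ x v → ones v ≤ ones (x ++ v)
ones-≤-++ [] v = ≤-refl
ones-≤-++ (true ∷ x) v = m≤n⇒m≤1+n (ones-≤-++ x v)
ones-≤-++ (false ∷ x) v = ones-≤-++ x v

ones-take-≤ : ∀ n v → ones (take n v) ≤ ones v
ones-take-≤ zero v = z≤n
ones-take-≤ (suc n) [] = z≤n
ones-take-≤ (suc n) (true ∷ v) = s≤s (ones-take-≤ n v)
ones-take-≤ (suc n) (false ∷ v) = ones-take-≤ n v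

maxPrefix : ℕ → List Bool → ℕ
maxPrefix c [] = 0
maxPrefix c (true ∷ v) = suc (maxPrefix c v)
maxPrefix zero (false ∷ v) = 0
maxPrefix (suc c) (false ∷ v) = suc (maxPrefix c v)

≤maxPrefix⇒≤ones+ : ∀ {m} c v → m ≤ maxPrefix c v → m ≤ ones (take m v) + c
≤maxPrefix⇒≤ones+ {zero} c v _ = z≤n
≤maxPrefix⇒≤ones+ {suc m} c (true ∷ v) (s≤s m≤) = s≤s (≤maxPrefix⇒≤ones+ c v m≤)
≤maxPrefix⇒≤ones+ {suc m} (suc c) (false ∷ v) (s≤s m≤) =
  ≤-trans (s≤s (≤maxPrefix⇒≤ones+ c v m≤)) (≤-reflexive (sym (+-suc _ c)))

MaxOnesWindow : ℕ → List Bool → List Bool → Set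
MaxOnesWindow n w u = ∀ x v → w ≡ x ++ v → ones (take n v) ≤ ones u

maxOnesWindow : ∀ n w → n ≤ length w →
  ∃[ x ] ∃[ u ] ∃[ y ] (w ≡ x ++ u ++ y × length u ≡ n × MaxOnesWindow n w u)
maxOnesWindow zero [] _ = [] , [] , [] , refl , refl , λ _ _ _ → z≤n
maxOnesWindow n (a ∷ w) n≤ with n ≤? length w
... | no n≰ = [] , a ∷ w , [] , sym (++-identityʳ (a ∷ w)) , ≤-antisym (≰⇒> n≰) n≤ , whole
  where
  whole : MaxOnesWindow n (a ∷ w) (a ∷ w)
  whole x v eq =
    ≤-trans (ones-take-≤ n v) (subst (λ w′ → ones v ≤ ones w′) (sym eq) (ones-≤-++ x v))
... | yes n≤′ with maxOnesWindow n w n≤′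
... | x , u , y , w≡ , |u|≡n , max with ones (take n (a ∷ w)) ≤? ones u
...   | yes ≤u = a ∷ x , u , y , cong (a ∷_) w≡ , |u|≡n , later
  where
  later : MaxOnesWindow n (a ∷ w) u
  later [] v refl = ≤u
  later (_ ∷ x′) v eq = max x′ v (∷-injectiveʳ eq)
...   | no ≰u = [] , take n (a ∷ w) , drop n (a ∷ w) , sym (take++drop≡id n (a ∷ w)) ,
               trans (length-take n (a ∷ w)) (m≤n⇒m⊓n≡m n≤) , first
  where
  first : MaxOnesWindow n (a ∷ w) (take n (a ∷ w))
  first [] v refl = ≤-refl
  first (_ ∷ x′) v eq = ≤-trans (max x′ v (∷-injectiveʳ eq)) (<⇒≤ (≰⇒> ≰u))

blocks : ℕ → List Bool → List ℕ
blocks n [] = suc n ∷ []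
blocks n (true ∷ u) = blocks (suc n) u
blocks n (false ∷ u) = n ∷ blocks 0 u

fBlocks : ℕ → List Bool → List ℕ
fBlocks n [] = suc (suc n) ∷ []
fBlocks n (true ∷ u) = fBlocks (suc n) u
fBlocks n (false ∷ u) = suc (suc n) ∷ fBlocks 0 u

sucHead : List ℕ → List ℕ
sucHead [] = []
sucHead (x ∷ S) = suc x ∷ S

blocks-suc : ∀ n u → blocks (suc n) u ≡ sucHead (blocks n u)
blocks-suc n [] = refl
blocks-suc n (true ∷ u) = blocks-suc (suc n) u
blocks-suc n (false ∷ u) = refl

blocks-∷ : ∀ n u → ∃₂ λ y r → blocks n u ≡ y ∷ r × 1 ≤ lastOr y r
blocks-∷ n [] = suc n , [] , refl , s≤s z≤n
blocks-∷ n (true ∷ u) = blocks-∷ (suc n) u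
blocks-∷ n (false ∷ u) with blocks 0 u | blocks-∷ 0 u
... | _ | y , r , refl , last≥1 = n , y ∷ r , refl , last≥1

blocks-∷ʳ : ∀ n u → ∃₂ λ P m → blocks n u ≡ P ∷ʳ suc m
blocks-∷ʳ n [] = [] , n , refl
blocks-∷ʳ n (true ∷ u) = blocks-∷ʳ (suc n) u
blocks-∷ʳ n (false ∷ u) with blocks-∷ʳ 0 u
... | P , m , eq = n ∷ P , m , cong (n ∷_) eq

incLast-∷ʳ : ∀ P x → incLast (P ∷ʳ x) ≡ P ∷ʳ suc x
incLast-∷ʳ [] x = refl
incLast-∷ʳ (p ∷ []) x = refl
incLast-∷ʳ (p ∷ q ∷ P) x = cong (p ∷_) (incLast-∷ʳ (q ∷ P) x)

decLast-∷ʳ : ∀ P x → decLast (P ∷ʳ suc x) ≡ P ∷ʳ x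
decLast-∷ʳ [] x = refl
decLast-∷ʳ (p ∷ []) x = refl
decLast-∷ʳ (p ∷ q ∷ P) x = cong (p ∷_) (decLast-∷ʳ (q ∷ P) x)

foldl-rcStep : ∀ P n u → foldl rcStep (P ∷ʳ suc n) u ≡ P ++ blocks n u
foldl-rcStep P n [] = refl
foldl-rcStep P n (true ∷ u) =
  trans (cong (λ S → foldl rcStep S u) (incLast-∷ʳ P (suc n))) (foldl-rcStep P (suc n) u)
foldl-rcStep P n (false ∷ u) = begin
  foldl rcStep (decLast (P ∷ʳ suc n) ∷ʳ 1) u
    ≡⟨ cong (λ S → foldl rcStep (S ∷ʳ 1) u) (decLast-∷ʳ P n) ⟩
  foldl rcStep (P ∷ʳ n ∷ʳ 1) u   ≡⟨ foldl-rcStep (P ∷ʳ n) 0 u ⟩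
  P ∷ʳ n ++ blocks 0 u           ≡⟨ ∷ʳ-++ P n (blocks 0 u) ⟩
  P ++ n ∷ blocks 0 u            ∎
  where open ≡-Reasoning

RC≡blocks : ∀ w → RC w ≡ blocks 1 w
RC≡blocks = foldl-rcStep [] 1

length-blocks : ∀ n u → length (blocks n u) ≡ suc (zeros u)
length-blocks n [] = refl
length-blocks n (true ∷ u) = length-blocks (suc n) u
length-blocks n (false ∷ u) = cong suc (length-blocks 0 u)

sum-blocks : ∀ n u → sum (blocks n u) ≡ suc n + ones u
sum-blocks n [] = refl
sum-blocks n (true ∷ u) = trans (sum-blocks (suc n) u) (sym (cong suc (+-suc n (ones u))))
sum-blocks n (false ∷ u) = trans (cong (n +_) (sum-blocks 0 u)) (+-suc n (ones u))

length-RC : ∀ w → length (RC w) ≡ suc (zeros w)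
length-RC w = trans (cong length (RC≡blocks w)) (length-blocks 1 w)

leaves-RC : ∀ w → leaves (RC w) ≡ 2 + ones w
leaves-RC w = trans (cong sum (RC≡blocks w)) (sum-blocks 1 w)

size-RC : ∀ w → size (RC w) ≡ length w + 3
size-RC w = begin
  length (RC w) + leaves (RC w) ≡⟨ cong₂ _+_ (length-RC w) (leaves-RC w) ⟩
  suc (zeros w) + (2 + ones w)  ≡⟨ +-comm (suc (zeros w)) (2 + ones w) ⟩
  2 + (ones w + suc (zeros w))  ≡⟨ cong (2 +_) (+-suc (ones w) (zeros w)) ⟩
  3 + (ones w + zeros w)        ≡⟨ cong (3 +_) (ones+zeros≡length w) ⟩
  3 + length w                  ≡⟨ +-comm 3 (length w) ⟩
  length w + 3                  ∎
  where open ≡-Reasoning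

isCaterpillar-RC : ∀ w → IsCaterpillar (RC w)
isCaterpillar-RC w = subst IsCaterpillar (sym (RC≡blocks w)) (isCaterpillar-blocks 0 w)
  where
  isCaterpillar-blocks : ∀ n u → IsCaterpillar (blocks (suc n) u)
  isCaterpillar-blocks n [] = s≤s (s≤s z≤n)
  isCaterpillar-blocks n (true ∷ u) = isCaterpillar-blocks (suc n) u
  isCaterpillar-blocks n (false ∷ u) with blocks 0 u | blocks-∷ 0 u
  ... | _ | y , r , refl , last≥1 = s≤s z≤n , last≥1

f-sucHead : ∀ S → f (sucHead S) ≡ sucHead (f S)
f-sucHead [] = refl
f-sucHead (x ∷ []) = refl
f-sucHead (x ∷ y ∷ r) = refl

f-∷-∷ : ∀ x y r → f (x ∷ y ∷ r) ≡ suc x ∷ sucHead (f (y ∷ r))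
f-∷-∷ x y [] = refl
f-∷-∷ x y (z ∷ r) = refl

sucHead-f-blocks : ∀ n u → sucHead (f (blocks n u)) ≡ fBlocks n u
sucHead-f-blocks n [] = refl
sucHead-f-blocks n (true ∷ u) = sucHead-f-blocks (suc n) u
sucHead-f-blocks n (false ∷ u) with blocks 0 u | blocks-∷ 0 u | sucHead-f-blocks 0 u
... | _ | y , r , refl , _ | ih = cong sucHead (trans (f-∷-∷ n y r) (cong (suc n ∷_) ih))

f-RC : ∀ w → f (RC w) ≡ fBlocks 0 w
f-RC w = begin
  f (RC w)                  ≡⟨ cong f (trans (RC≡blocks w) (blocks-suc 0 w)) ⟩
  f (sucHead (blocks 0 w))  ≡⟨ f-sucHead (blocks 0 w) ⟩
  sucHead (f (blocks 0 w))  ≡⟨ sucHead-f-blocks 0 w ⟩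
  fBlocks 0 w               ∎
  where open ≡-Reasoning

stepL-∷ : ∀ x L → 2 ≤ length L → stepL (x ∷ L) ≡ x ∷ stepL L
stepL-∷ x (y ∷ []) (s≤s ())
stepL-∷ x (zero ∷ z ∷ r) _ = refl
stepL-∷ x (suc zero ∷ z ∷ r) _ = refl
stepL-∷ x (suc (suc y) ∷ z ∷ r) _ = refl

stepL-∷ʳ-suc : ∀ P m → stepL (P ∷ʳ suc (suc m)) ≡ P ∷ʳ suc m
stepL-∷ʳ-suc [] m = refl
stepL-∷ʳ-suc (p ∷ []) m = refl
stepL-∷ʳ-suc (p ∷ q ∷ P) m =
  trans (stepL-∷ p (q ∷ P ∷ʳ _) (s≤s (length-++-≤ʳ (_ ∷ []) {P})))
        (cong (p ∷_) (stepL-∷ʳ-suc (q ∷ P) m))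

stepL-++-∷-1 : ∀ P m → stepL (P ++ m ∷ 1 ∷ []) ≡ P ∷ʳ suc m
stepL-++-∷-1 [] m = refl
stepL-++-∷-1 (p ∷ P) m =
  trans (stepL-∷ p (P ++ m ∷ 1 ∷ []) (length-++-≤ʳ (m ∷ 1 ∷ []) {P}))
        (cong (p ∷_) (stepL-++-∷-1 P m))

stepL-rcStep : ∀ P m a → stepL (rcStep (P ∷ʳ suc m) a) ≡ P ∷ʳ suc m
stepL-rcStep P m true = trans (cong stepL (incLast-∷ʳ P (suc m))) (stepL-∷ʳ-suc P m)
stepL-rcStep P m false = begin
  stepL (decLast (P ∷ʳ suc m) ∷ʳ 1) ≡⟨ cong (λ S → stepL (S ∷ʳ 1)) (decLast-∷ʳ P m) ⟩
  stepL (P ∷ʳ m ∷ʳ 1)              ≡⟨ cong stepL (∷ʳ-++ P m (1 ∷ [])) ⟩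
  stepL (P ++ m ∷ 1 ∷ [])          ≡⟨ stepL-++-∷-1 P m ⟩
  P ∷ʳ suc m                       ∎
  where open ≡-Reasoning

stepL-RC : ∀ v a → stepL (RC (v ∷ʳ a)) ≡ RC v
stepL-RC v a with blocks-∷ʳ 1 v
... | P , m , eq = begin
  stepL (RC (v ∷ʳ a))          ≡⟨ cong stepL (foldl-∷ʳ rcStep (2 ∷ []) a v) ⟩
  stepL (rcStep (RC v) a)      ≡⟨ cong (λ S → stepL (rcStep S a)) RCv≡ ⟩
  stepL (rcStep (P ∷ʳ suc m) a) ≡⟨ stepL-rcStep P m a ⟩
  P ∷ʳ suc m                   ≡⟨ sym RCv≡ ⟩
  RC v                         ∎
  where
  open ≡-Reasoning
  RCv≡ : RC v ≡ P ∷ʳ suc m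
  RCv≡ = trans (RC≡blocks v) eq

stepR-RC : ∀ a u → stepR (RC (a ∷ u)) ≡ RC u
stepR-RC true u rewrite RC≡blocks (true ∷ u) | RC≡blocks u | blocks-suc 1 u | blocks-suc 0 u
  with blocks 0 u | blocks-∷ 0 u
... | _ | y , r , refl , _ = refl
stepR-RC false u rewrite RC≡blocks (false ∷ u) | RC≡blocks u | blocks-suc 0 u
  with blocks 0 u | blocks-∷ 0 u
... | _ | y , r , refl , _ = refl

iter-suc : ∀ n (g : List ℕ → List ℕ) S → iter (suc n) g S ≡ g (iter n g S)
iter-suc zero g S = refl
iter-suc (suc n) g S = iter-suc n g (g S)

iter-stepL-RC : ∀ v y → iter (length y) stepL (RC (v ++ y)) ≡ RC v
iter-stepL-RC v [] = cong RC (++-identityʳ v)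
iter-stepL-RC v (a ∷ y) = begin
  iter (suc (length y)) stepL (RC (v ++ a ∷ y))
    ≡⟨ iter-suc (length y) stepL _ ⟩
  stepL (iter (length y) stepL (RC (v ++ a ∷ y)))
    ≡⟨ cong (λ w → stepL (iter (length y) stepL (RC w))) (sym (∷ʳ-++ v a y)) ⟩
  stepL (iter (length y) stepL (RC (v ∷ʳ a ++ y)))
    ≡⟨ cong stepL (iter-stepL-RC (v ∷ʳ a) y) ⟩
  stepL (RC (v ∷ʳ a))
    ≡⟨ stepL-RC v a ⟩
  RC v
    ∎
  where open ≡-Reasoning

iter-stepR-RC : ∀ x v → iter (length x) stepR (RC (x ++ v)) ≡ RC v
iter-stepR-RC [] v = refl
iter-stepR-RC (a ∷ x) v = trans (cong (iter (length x) stepR) (stepR-RC a (x ++ v))) (iter-stepR-RC x v)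

size-RC-++ : ∀ x v → size (RC (x ++ v)) ≡ length x + length v + 3
size-RC-++ x v = trans (size-RC (x ++ v)) (cong (_+ 3) (length-++ x))

Left-RC : ∀ v y → Left (length v + 3) (RC (v ++ y)) ≡ RC v
Left-RC v y = trans (cong (λ k → iter k stepL (RC (v ++ y))) steps) (iter-stepL-RC v y)
  where
  steps : size (RC (v ++ y)) ∸ (length v + 3) ≡ length y
  steps = trans (cong (_∸ (length v + 3)) (trans (size-RC-++ v y) (rearrange (length v) (length y))))
                (m+n∸m≡n (length v + 3) (length y))
    where
    rearrange : ∀ a b → a + b + 3 ≡ a + 3 + b
    rearrange = solve-∀

Right-RC : ∀ x v → Right (length v + 3) (RC (x ++ v)) ≡ RC v
Right-RC x v = trans (cong (λ k → iter k stepR (RC (x ++ v))) steps) (iter-stepR-RC x v)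
  where
  steps : size (RC (x ++ v)) ∸ (length v + 3) ≡ length x
  steps = trans (cong (_∸ (length v + 3)) (trans (size-RC-++ x v) (+-assoc (length x) (length v) 3)))
                (m+n∸n≡m (length x) (length v + 3))

drop-zeros-fBlocks : ∀ x n v → ∃[ n′ ] drop (zeros x) (fBlocks n (x ++ v)) ≡ fBlocks n′ v
drop-zeros-fBlocks [] n v = n , refl
drop-zeros-fBlocks (true ∷ x) n v = drop-zeros-fBlocks x (suc n) v
drop-zeros-fBlocks (false ∷ x) n v = drop-zeros-fBlocks x 0 v

fBlocks-≤*-++ : ∀ {m n} u y → m ≤ n → fBlocks m u ≤* fBlocks n (u ++ y)
fBlocks-≤*-++ [] [] m≤n = ∷≤ (s≤s (s≤s m≤n)) []≤
fBlocks-≤*-++ [] (true ∷ y) m≤n = fBlocks-≤*-++ [] y (m≤n⇒m≤1+n m≤n)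
fBlocks-≤*-++ [] (false ∷ y) m≤n = ∷≤ (s≤s (s≤s m≤n)) []≤
fBlocks-≤*-++ (true ∷ u) y m≤n = fBlocks-≤*-++ u y (s≤s m≤n)
fBlocks-≤*-++ (false ∷ u) y m≤n = ∷≤ (s≤s (s≤s m≤n)) (fBlocks-≤*-++ u y z≤n)

RC-infix-⪯ : ∀ x u y → RC u ⪯ RC (x ++ u ++ y)
RC-infix-⪯ x u y = zeros x , fits , f≤*
  where
  fits : zeros x + length (RC u) ≤ length (RC (x ++ u ++ y))
  fits rewrite length-RC u | length-RC (x ++ u ++ y) | zeros-++ x (u ++ y) | zeros-++ u y =
    ≤-trans (≤-reflexive (+-suc (zeros x) (zeros u)))
            (s≤s (+-monoʳ-≤ (zeros x) (m≤m+n (zeros u) (zeros y))))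
  f≤* : f (RC u) ≤* drop (zeros x) (f (RC (x ++ u ++ y)))
  f≤* rewrite f-RC u | f-RC (x ++ u ++ y) with drop-zeros-fBlocks x 0 (u ++ y)
  ... | n′ , eq = subst (fBlocks 0 u ≤*_) (sym eq) (fBlocks-≤*-++ u y z≤n)

≤*-drop-fBlocks : ∀ {xs} q w → xs ≤* drop q (fBlocks 0 w) →
  ∃₂ λ x v → w ≡ x ++ v × xs ≤* fBlocks 0 v
≤*-drop-fBlocks zero w xs≤* = [] , w , refl , xs≤*
≤*-drop-fBlocks (suc q) w xs≤* = shifted q 0 w xs≤*
  where
  shifted : ∀ {xs} q n w → xs ≤* drop (suc q) (fBlocks n w) →
    ∃₂ λ x v → w ≡ x ++ v × xs ≤* fBlocks 0 v
  shifted zero n [] []≤ = [] , [] , refl , []≤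
  shifted (suc q) n [] []≤ = [] , [] , refl , []≤
  shifted q n (true ∷ w) xs≤* with shifted q (suc n) w xs≤*
  ... | x , v , refl , xs≤*′ = true ∷ x , v , refl , xs≤*′
  shifted zero n (false ∷ w) xs≤* = false ∷ [] , w , refl , xs≤*
  shifted (suc q) n (false ∷ w) xs≤* with shifted q 0 w xs≤*
  ... | x , v , refl , xs≤*′ = false ∷ x , v , refl , xs≤*′

length-f : ∀ S → length (f S) ≡ length S
length-f [] = refl
length-f (x ∷ []) = refl
length-f (x ∷ y ∷ []) = refl
length-f (x ∷ y ∷ z ∷ r) = cong suc (length-f (y ∷ z ∷ r))

sum-f : ∀ t ts → sum (f (t ∷ ts)) ≡ sum (t ∷ ts) + (length ts + length ts)
sum-f t [] = sym (+-identityʳ (t + 0))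
sum-f t (y ∷ []) = shift t y
  where
  shift : ∀ t y → suc t + (suc y + 0) ≡ t + (y + 0) + 2
  shift = solve-∀
sum-f t (y ∷ z ∷ r) =
  trans (cong (λ s → suc t + suc s) (sum-f y (z ∷ r))) (shift t (sum (y ∷ z ∷ r)) (length r))
  where
  shift : ∀ t s l → suc t + suc (s + (suc l + suc l)) ≡ t + s + (suc (suc l) + suc (suc l))
  shift = solve-∀

sum-≤*-fBlocks : ∀ {xs} c n v → length xs ≡ suc c → xs ≤* fBlocks n v →
  sum xs ≤ 2 + c + (n + maxPrefix c v)
sum-≤*-fBlocks {[]} c n v () _
sum-≤*-fBlocks c n [] refl (∷≤ a≤ []≤) = +-mono-≤ a≤ z≤n
sum-≤*-fBlocks c n (true ∷ v) |xs| xs≤* =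
  ≤-trans (sum-≤*-fBlocks c (suc n) v |xs| xs≤*)
          (≤-reflexive (cong (2 + c +_) (sym (+-suc n (maxPrefix c v)))))
sum-≤*-fBlocks zero n (false ∷ v) refl (∷≤ {xs = []} a≤ _) = +-mono-≤ a≤ z≤n
sum-≤*-fBlocks zero n (false ∷ v) () (∷≤ {xs = _ ∷ _} _ _)
sum-≤*-fBlocks (suc c) n (false ∷ v) |xs| (∷≤ a≤ xs≤*) =
  ≤-trans (+-mono-≤ a≤ (sum-≤*-fBlocks c 0 v (suc-injective |xs|) xs≤*))
          (≤-reflexive (shift n c (maxPrefix c v)))
  where
  shift : ∀ n c m → suc (suc n) + (2 + c + m) ≡ 2 + suc c + (n + suc m)
  shift = solve-∀

size-≤-maxPrefix : ∀ t ts v → f (t ∷ ts) ≤* fBlocks 0 v →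
  size (t ∷ ts) ≤ maxPrefix (length ts) v + 3
size-≤-maxPrefix t ts v f≤* =
  +-cancelʳ-≤ L (suc (L + s)) (M + 3) (subst₂ _≤_ (regroupˡ L s) (regroupʳ L M) (s≤s sum-bound))
  where
  L = length ts
  s = sum (t ∷ ts)
  M = maxPrefix L v
  sum-bound : s + (L + L) ≤ 2 + L + M
  sum-bound = subst (_≤ 2 + L + M) (sum-f t ts) (sum-≤*-fBlocks L 0 v (length-f (t ∷ ts)) f≤*)
  regroupˡ : ∀ L s → suc (s + (L + L)) ≡ suc (L + s) + L
  regroupˡ = solve-∀
  regroupʳ : ∀ L M → suc (2 + L + M) ≡ M + 3 + L
  regroupʳ = solve-∀

leaves-⪯-RC : ∀ {T} n w → IsCaterpillar T → T ⪯ RC w → size T ≡ n + 3 →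
  ∃₂ λ x v → w ≡ x ++ v × leaves T ≤ 2 + ones (take n v)
leaves-⪯-RC {t ∷ ts} n w _ (q , _ , f≤*) size≡
  with ≤*-drop-fBlocks q w (subst (λ S → f (t ∷ ts) ≤* drop q S) (f-RC w) f≤*)
... | x , v , w≡ , f≤*′ = x , v , w≡ , +-cancelʳ-≤ L (leaves (t ∷ ts)) (2 + o) (begin
    leaves (t ∷ ts) + L ≡⟨ +-comm (leaves (t ∷ ts)) L ⟩
    L + leaves (t ∷ ts) ≡⟨ suc-injective (trans size≡ (+-suc n 2)) ⟩
    n + 2               ≤⟨ +-monoˡ-≤ 2 n≤o+L ⟩
    o + L + 2           ≡⟨ regroup o L ⟩
    2 + o + L           ∎)
  where
  open ≤-Reasoning
  L = length ts
  o = ones (take n v)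
  n≤o+L : n ≤ o + L
  n≤o+L = ≤maxPrefix⇒≤ones+ L v (+-cancelʳ-≤ 3 n (maxPrefix L v)
            (subst (_≤ maxPrefix L v + 3) size≡ (size-≤-maxPrefix t ts v f≤*′)))
  regroup : ∀ o L → o + L + 2 ≡ 2 + o + L
  regroup = solve-∀

RC-fullyLeafed : ∀ x u y → MaxOnesWindow (length u) (x ++ u ++ y) u →
  FullyLeafed (RC (x ++ u ++ y)) (RC u) (length u + 3)
RC-fullyLeafed x u y max = isCaterpillar-RC u , RC-infix-⪯ x u y , size-RC u , maximal
  where
  maximal : ∀ T → IsCaterpillar T → T ⪯ RC (x ++ u ++ y) → size T ≡ length u + 3 →
    leaves T ≤ leaves (RC u)
  maximal T cat T⪯ size≡ with leaves-⪯-RC (length u) (x ++ u ++ y) cat T⪯ size≡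
  ... | x′ , v , w≡ , bound =
    ≤-trans bound (≤-trans (+-monoʳ-≤ 2 (max x′ v w≡)) (≤-reflexive (sym (leaves-RC u))))

Left-Right-RC : ∀ x u y →
  Left (length u + 3) (Right (length (u ++ y) + 3) (RC (x ++ u ++ y))) ≡ RC u
Left-Right-RC x u y = trans (cong (Left (length u + 3)) (Right-RC x (u ++ y))) (Left-RC u y)

Right-Left-RC : ∀ x u y →
  Right (length u + 3) (Left (length (x ++ u) + 3) (RC (x ++ u ++ y))) ≡ RC u
Right-Left-RC x u y = begin
  Right (length u + 3) (Left (length (x ++ u) + 3) (RC (x ++ u ++ y)))
    ≡⟨ cong (λ w → Right (length u + 3) (Left (length (x ++ u) + 3) (RC w))) (sym (++-assoc x u y)) ⟩
  Right (length u + 3) (Left (length (x ++ u) + 3) (RC ((x ++ u) ++ y)))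
    ≡⟨ cong (Right (length u + 3)) (Left-RC (x ++ u) y) ⟩
  Right (length u + 3) (RC (x ++ u))
    ≡⟨ Right-RC x u ⟩
  RC u
    ∎
  where open ≡-Reasoning

lemma10 : (w : List Bool) (i : ℕ) → 3 ≤ i → i ≤ length w + 3 →
    (∃[ j ] ((i ≤ j) × (j ≤ length w + 3) × FullyLeafed (RC w) (Left i (Right j (RC w))) i))
    × (∃[ j' ] ((i ≤ j') × (j' ≤ length w + 3) × FullyLeafed (RC w) (Right i (Left j' (RC w))) i))
lemma10 w i 3≤i i≤|w|+3
  with maxOnesWindow (i ∸ 3) w (subst (i ∸ 3 ≤_) (m+n∸n≡m (length w) 3) (∸-monoˡ-≤ 3 i≤|w|+3))
... | x , u , y , refl , |u|≡ , max with trans (cong (_+ 3) |u|≡) (m∸n+n≡m 3≤i)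
... | refl =
    (length (u ++ y) + 3 , +-monoˡ-≤ 3 (length-++-≤ˡ u) , +-monoˡ-≤ 3 (length-++-≤ʳ (u ++ y) {x}) ,
     subst (λ S → FullyLeafed (RC W) S _) (sym (Left-Right-RC x u y)) fullyLeafed)
  , (length (x ++ u) + 3 , +-monoˡ-≤ 3 (length-++-≤ʳ u {x}) , +-monoˡ-≤ 3 (x++u≤W) ,
     subst (λ S → FullyLeafed (RC W) S _) (sym (Right-Left-RC x u y)) fullyLeafed)
  where
  W = x ++ u ++ y
  fullyLeafed : FullyLeafed (RC W) (RC u) (length u + 3)
  fullyLeafed = RC-fullyLeafed x u y (subst (λ n → MaxOnesWindow n W u) (m+n∸n≡m (length u) 3) max)
  x++u≤W : length (x ++ u) ≤ length W
  x++u≤W = subst (λ w → length (x ++ u) ≤ length w) (++-assoc x u y) (length-++-≤ˡ (x ++ u))
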